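{- The folded cubes $\mathrm{FQ}_1$ and $\mathrm{FQ}_2$ are $[1,0,4]$-cycle regular. The folded cube $\mathrm{FQ}_4$ is $[1,9,4]$-cycle regular. For every integer $n\ge 1$ with $n\notin\{1,2,4\}$, the folded cube $\mathrm{FQ}_n$ is $[1,n-1,4]$-cycle regular.
   Context: For $n\ge 1$, the folded cube $\mathrm{FQ}_n$ is the simple graph with vertex set $\{0,1\}^{n-1}$ in which two distinct vertices are adjacent if and only if they differ in exactly one coordinate or one is the coordinatewise complement of the other (equivalently, $\mathrm{FQ}_n$ is obtained from the $n$-dimensional hypercube by identifying antipodal vertices). For integers $l,\lambda,m$, a simple graph is $[l,\lambda,m]$-cycle regular if every path on $l+1$ vertices belongs to exactly $\lambda$ different cycles of length $m$. -}

module Defs where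

open import Data.Bool using (Bool; true; false; not; _∧_; _∨_; T; if_then_else_)
open import Data.Nat using (ℕ; zero; suc; _∸_; _≤ᵇ_)
open import Data.Fin using (Fin)
open import Data.Vec using (Vec; []; _∷_; map; toList)
open import Data.List using (List; []; _∷_)
open import Data.Product using (Σ)
open import Function.Bundles using (_↔_)
open import Relation.Binary.Definitions using (DecidableEquality)
open import Relation.Nullary.Decidable using (⌊_⌋)

-- Generic simple graphs, given by a vertex type with decidable equality
-- and a Boolean adjacency relation (assumed symmetric and irreflexive).

module CycleReg {V : Set} (_≟_ : DecidableEquality V) (adj : V → V → Bool) where

  notIn : V → List V → Bool
  notIn x []       = true
  notIn x (y ∷ ys) = not ⌊ x ≟ y ⌋ ∧ notIn x ys

  distinct : List V → Bool
  distinct []       = true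
  distinct (x ∷ xs) = notIn x xs ∧ distinct xs

  chain : List V → Bool
  chain []           = true
  chain (x ∷ [])     = true
  chain (x ∷ y ∷ ys) = adj x y ∧ chain (y ∷ ys)

  lastOr : V → List V → V
  lastOr d []       = d
  lastOr d (x ∷ xs) = lastOr x xs

  prefix : List V → List V → Bool
  prefix []       _        = true
  prefix (x ∷ xs) []       = false
  prefix (x ∷ xs) (y ∷ ys) = ⌊ x ≟ y ⌋ ∧ prefix xs ys

  isPath : List V → Bool
  isPath xs = distinct xs ∧ chain xs

  isCycle : List V → Bool
  isCycle []       = false
  isCycle (x ∷ xs) = (3 ≤ᵇ suc (Data.List.length xs)) ∧ distinct (x ∷ xs)
                     ∧ chain (x ∷ xs) ∧ adj (lastOr x xs) x

  -- The cycles of length m containing the path p (on l+1 ≥ 2 vertices)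
  -- are in bijection with the vertex sequences (c₀,…,c_{m-1}) forming a
  -- cycle whose first l+1 entries are p (in order): the start vertex and
  -- orientation of the cycle are fixed by p.
  CyclesThrough : {l : ℕ} (m : ℕ) → Vec V (suc l) → Set
  CyclesThrough m p =
    Σ (Vec V m) (λ c → T (isCycle (toList c) ∧ prefix (toList p) (toList c)))

  CycleRegular : ℕ → ℕ → ℕ → Set
  CycleRegular l λ' m =
    (p : Vec V (suc l)) → T (isPath (toList p)) → Fin λ' ↔ CyclesThrough m p

open import Data.Vec.Properties using (≡-dec)
import Data.Bool.Properties as BP

FQVertex : ℕ → Set
FQVertex n = Vec Bool (n ∸ 1)

eqV : {k : ℕ} → DecidableEquality (Vec Bool k)
eqV = ≡-dec BP._≟_

hamming : {k : ℕ} → Vec Bool k → Vec Bool k → ℕ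
hamming []       []       = 0
hamming (a ∷ xs) (b ∷ ys) = if ⌊ a BP.≟ b ⌋ then hamming xs ys else suc (hamming xs ys)

isOne : ℕ → Bool
isOne (suc zero) = true
isOne _          = false

adjFQ : {k : ℕ} → Vec Bool k → Vec Bool k → Bool
adjFQ x y = not ⌊ eqV x y ⌋ ∧ (isOne (hamming x y) ∨ ⌊ eqV y (map not x) ⌋)

FQCycleRegular : (n l λ' m : ℕ) → Set
FQCycleRegular n = CycleReg.CycleRegular {FQVertex n} eqV adjFQ

-- FQ_n is the Cayley graph of ℤ₂^K (K = n − 1) for the n generators e₁, …, e_K and
-- 1 = e₁ + ⋯ + e_K.  A 4-cycle through the edge (a, a + g₁) is a closed walk
-- a, a + g₁, a + g₁ + g₂, a + g₁ + g₂ + g₃ with g₁ + g₂ + g₃ + g₄ = 0 and cyclically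
-- consecutive generators distinct.  When K ≥ 4, one, two or four distinct generators always
-- flip some coordinate an odd number of times, so they never sum to 0; hence g₃ = g₁ and
-- g₄ = g₂, and the 4-cycles through the edge correspond to the n − 1 choices of g₂ ≠ g₁.
-- For n ≤ 4 (where e₁ + e₂ + e₃ + 1 = 0 once n = 4) the counts are found by enumeration.

module Submission where

open import Defs
open import Data.Bool using (Bool; true; false; not; _∧_; _∨_; _xor_; T)
open import Data.Bool.Properties
  using (T-irrelevant; T-≡; T-∧; T-∨; ∨-identityʳ; ∧-identityʳ; not-¬; xor-assoc; xor-comm; xor-same)
open import Data.Empty using (⊥-elim)
open import Data.Fin using (Fin; zero; suc; punchIn; punchOut)
import Data.Fin as Fin
open import Data.Fin.Properties
  using (¬∀⟶∃¬; pigeonhole; <⇒≢; +↔⊎; punchInᵢ≢i; punchOut-cong; punchOut-punchIn; punchIn-punchOut)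
open import Data.List using (List; []; _∷_; _++_; foldr)
open import Data.List.Relation.Unary.All using (All; []; _∷_)
open import Data.List.Relation.Unary.AllPairs using ([]; _∷_)
open import Data.List.Relation.Unary.Unique.Propositional using (Unique)
open import Data.Nat using (ℕ; zero; suc; _+_; _<_; _≤_; _∸_; _≡ᵇ_; z≤n; s≤s)
open import Data.Nat.Properties using (≡ᵇ⇒≡; ≤-trans; suc-injective)
open import Data.Product using (Σ; ∃; _×_; _,_; proj₁; proj₂)
open import Data.Product.Function.Dependent.Propositional using (Σ-↔)
open import Data.Sum using (_⊎_; inj₁; inj₂)
open import Data.Sum.Function.Propositional using (_⊎-↔_)
open import Data.Unit using (tt)
open import Data.Vec using (Vec; []; _∷_; lookup; map; updateAt; toList)
open import Data.Vec.Membership.Propositional using (_∈_; _∉_)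
import Data.Vec.Membership.DecPropositional as DecMembership
open import Data.Vec.Properties
  using (lookup-map; lookup∘updateAt; lookup∘updateAt′; tabulate∘lookup; tabulate-cong)
open import Data.Vec.Relation.Unary.Any using (here; there; index)
open import Data.Vec.Relation.Unary.Any.Properties using (lookup-index)
open import Function using (_∘_)
open import Function.Bundles using (_↔_; mk↔ₛ′; Equivalence)
open import Function.Properties.Inverse using (↔-refl; ↔-sym; ↔-trans)
open import Relation.Binary.Definitions using (DecidableEquality)
open import Relation.Binary.PropositionalEquality
open import Relation.Nullary.Decidable
  using (⌊_⌋; yes; no; does; dec-true; dec-false; dec-no; dec-yes-recompute; toWitness)

∃-∉ : ∀ {m n} → m < n → (xs : Vec (Fin n) m) → ∃ λ r → r ∉ xs
∃-∉ {n = n} m<n xs = ¬∀⟶∃¬ n (_∈ xs) (_∈? xs) λ all∈ →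
  let i , j , i<j , same = pigeonhole m<n (λ r → index (all∈ r)) in
  <⇒≢ i<j (begin
    i                             ≡⟨ lookup-index (all∈ i) ⟩
    lookup xs (index (all∈ i))    ≡⟨ cong (lookup xs) same ⟩
    lookup xs (index (all∈ j))    ≡⟨ lookup-index (all∈ j) ⟨
    j                             ∎)
  where
  open ≡-Reasoning
  open DecMembership (Fin._≟_ {n}) using (_∈?_)

lookup-extensionality : ∀ {A : Set} {n} {xs ys : Vec A n} → (∀ r → lookup xs r ≡ lookup ys r) → xs ≡ ys
lookup-extensionality {xs = xs} {ys} eq =
  trans (sym (tabulate∘lookup xs)) (trans (tabulate-cong eq) (tabulate∘lookup ys))

T⇒≡true : ∀ {x} → T x → x ≡ true
T⇒≡true = Equivalence.to T-≡

≡true⇒T : ∀ {x} → x ≡ true → T x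
≡true⇒T = Equivalence.from T-≡

sumVec : ∀ k → (Vec Bool k → ℕ) → ℕ
sumVec zero    f = f []
sumVec (suc k) f = sumVec k (f ∘ (true ∷_)) + sumVec k (f ∘ (false ∷_))

Σ-Vec-suc↔ : ∀ {k} (P : Vec Bool (suc k) → Set) →
  Σ (Vec Bool (suc k)) P ↔ (Σ (Vec Bool k) (P ∘ (true ∷_)) ⊎ Σ (Vec Bool k) (P ∘ (false ∷_)))
Σ-Vec-suc↔ {k} P = mk↔ₛ′ split join split∘join join∘split
  where
  split : Σ (Vec Bool (suc k)) P → Σ (Vec Bool k) (P ∘ (true ∷_)) ⊎ Σ (Vec Bool k) (P ∘ (false ∷_))
  split (true  ∷ x , p) = inj₁ (x , p)
  split (false ∷ x , p) = inj₂ (x , p)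
  join : Σ (Vec Bool k) (P ∘ (true ∷_)) ⊎ Σ (Vec Bool k) (P ∘ (false ∷_)) → Σ (Vec Bool (suc k)) P
  join (inj₁ (x , p)) = true  ∷ x , p
  join (inj₂ (x , p)) = false ∷ x , p
  split∘join : ∀ y → split (join y) ≡ y
  split∘join (inj₁ _) = refl
  split∘join (inj₂ _) = refl
  join∘split : ∀ y → join (split y) ≡ y
  join∘split (true  ∷ _ , _) = refl
  join∘split (false ∷ _ , _) = refl

Σ-Fin↔Fin-sumVec : ∀ k (f : Vec Bool k → ℕ) → Σ (Vec Bool k) (Fin ∘ f) ↔ Fin (sumVec k f)
Σ-Fin↔Fin-sumVec zero f =
  mk↔ₛ′ (λ { ([] , i) → i }) ([] ,_) (λ _ → refl) (λ { ([] , _) → refl })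
Σ-Fin↔Fin-sumVec (suc k) f =
  ↔-trans (Σ-Vec-suc↔ _) (↔-trans (Σ-Fin↔Fin-sumVec k _ ⊎-↔ Σ-Fin↔Fin-sumVec k _) (↔-sym +↔⊎))

indicator : Bool → ℕ
indicator true  = 1
indicator false = 0

T↔Fin-indicator : ∀ b → T b ↔ Fin (indicator b)
T↔Fin-indicator true  = mk↔ₛ′ (λ _ → zero) (λ _ → tt) (λ { zero → refl }) (λ _ → refl)
T↔Fin-indicator false = mk↔ₛ′ (λ ()) (λ ()) (λ ()) (λ ())

allVec : ∀ k → (Vec Bool k → Bool) → Bool
allVec zero    P = P []
allVec (suc k) P = allVec k (P ∘ (true ∷_)) ∧ allVec k (P ∘ (false ∷_))

allVec-sound : ∀ k (P : Vec Bool k → Bool) → T (allVec k P) → ∀ x → T (P x)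
allVec-sound zero    P all [] = all
allVec-sound (suc k) P all (b ∷ x) with Equivalence.to (T-∧ {allVec k (P ∘ (true ∷_))}) all | b
... | all-true , _ | true  = allVec-sound k _ all-true x
... | _ , all-false | false = allVec-sound k _ all-false x

module Squares {V : Set} (_≟_ : DecidableEquality V) (adj : V → V → Bool) where
  open CycleReg _≟_ adj

  isSquare : V → V → V → V → Bool
  isSquare a b c d = isCycle (a ∷ b ∷ c ∷ d ∷ [])

  SquaresOn : V → V → Set
  SquaresOn a b = Σ V λ c → Σ V λ d → T (isSquare a b c d)

  record Square (a b c d : V) : Set where
    field
      a≢b : a ≢ b
      a≢c : a ≢ c
      a≢d : a ≢ d
      b≢c : b ≢ c
      b≢d : b ≢ d
      c≢d : c ≢ d
      ab : T (adj a b)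
      bc : T (adj b c)
      cd : T (adj c d)
      da : T (adj d a)

  Square⇒isSquare : ∀ {a b c d} → Square a b c d → T (isSquare a b c d)
  Square⇒isSquare {a} {b} {c} {d} s
    rewrite dec-no (a ≟ b) (Square.a≢b s) | dec-no (a ≟ c) (Square.a≢c s) | dec-no (a ≟ d) (Square.a≢d s)
          | dec-no (b ≟ c) (Square.b≢c s) | dec-no (b ≟ d) (Square.b≢d s) | dec-no (c ≟ d) (Square.c≢d s)
          | T⇒≡true (Square.ab s) | T⇒≡true (Square.bc s) | T⇒≡true (Square.cd s) | T⇒≡true (Square.da s)
          = tt

  isSquare⇒Square : ∀ {a b c d} → T (isSquare a b c d) → Square a b c d
  -- In every other combination T (isSquare a b c d) reduces to ⊥, so those cases are omitted.
  isSquare⇒Square {a} {b} {c} {d} _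
    with a ≟ b | a ≟ c | a ≟ d | b ≟ c | b ≟ d | c ≟ d
       | adj a b in ab | adj b c in bc | adj c d in cd | adj d a in da
  ... | no a≢b | no a≢c | no a≢d | no b≢c | no b≢d | no c≢d | true | true | true | true =
    record { a≢b = a≢b ; a≢c = a≢c ; a≢d = a≢d ; b≢c = b≢c ; b≢d = b≢d ; c≢d = c≢d
           ; ab = ≡true⇒T ab ; bc = ≡true⇒T bc ; cd = ≡true⇒T cd ; da = ≡true⇒T da }

  isPath⇒adj : ∀ {a b} → T (isPath (a ∷ b ∷ [])) → T (adj a b)
  isPath⇒adj {a} {b} _ with a ≟ b | adj a b
  ... | no _ | true = tt

  SquaresOn-≡ : ∀ {a b c c′ d d′} {s : T (isSquare a b c d)} {s′ : T (isSquare a b c′ d′)} →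
                c ≡ c′ → d ≡ d′ → _≡_ {A = SquaresOn a b} (c , d , s) (c′ , d′ , s′)
  SquaresOn-≡ refl refl = cong (λ s → _ , _ , s) (T-irrelevant _ _)

  cyclesThrough↔squaresOn : ∀ a b → CyclesThrough 4 (a ∷ b ∷ []) ↔ SquaresOn a b
  cyclesThrough↔squaresOn a b = mk↔ₛ′ to from to∘from from∘to
    where
    Starts : Vec V 4 → Set
    Starts (c₀ ∷ c₁ ∷ _ ∷ _ ∷ []) = a ≡ c₀ × b ≡ c₁

    starts : ∀ {cs} → T (isCycle (toList cs) ∧ prefix (a ∷ b ∷ []) (toList cs)) → Starts cs
    starts {c₀ ∷ c₁ ∷ c₂ ∷ c₃ ∷ []} t =
      let pre = proj₂ (Equivalence.to (T-∧ {isSquare c₀ c₁ c₂ c₃}) t)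
          a≟c₀ , rest = Equivalence.to (T-∧ {⌊ a ≟ c₀ ⌋}) pre
      in toWitness a≟c₀ , toWitness (proj₁ (Equivalence.to (T-∧ {⌊ b ≟ c₁ ⌋}) rest))

    to : CyclesThrough 4 (a ∷ b ∷ []) → SquaresOn a b
    to (cs@(c₀ ∷ c₁ ∷ c₂ ∷ c₃ ∷ []) , t) =
      let a≡c₀ , b≡c₁ = starts {cs} t in
      c₂ , c₃ , subst₂ (λ x y → T (isSquare x y c₂ c₃)) (sym a≡c₀) (sym b≡c₁)
                       (proj₁ (Equivalence.to (T-∧ {isSquare c₀ c₁ c₂ c₃}) t))

    from : SquaresOn a b → CyclesThrough 4 (a ∷ b ∷ [])
    from (c , d , s) = (a ∷ b ∷ c ∷ d ∷ []) , withPrefix s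
      where
      withPrefix : ∀ {x} → T x → T (x ∧ (⌊ a ≟ a ⌋ ∧ (⌊ b ≟ b ⌋ ∧ true)))
      withPrefix {x} s
        rewrite dec-yes-recompute (a ≟ a) refl | dec-yes-recompute (b ≟ b) refl | ∧-identityʳ x = s

    to∘from : ∀ y → to (from y) ≡ y
    to∘from _ = SquaresOn-≡ refl refl

    from∘to : ∀ y → from (to y) ≡ y
    from∘to (cs@(c₀ ∷ c₁ ∷ c₂ ∷ c₃ ∷ []) , t) with starts {cs} t
    ... | refl , refl = cong (cs ,_) (T-irrelevant _ _)

-- Generator zero is the complement 1, generator suc i flips coordinate i; act g x is x + g.
act : ∀ {K} → Fin (suc K) → Vec Bool K → Vec Bool K
act zero    x = map not x
act (suc i) x = updateAt x i not

flips : ∀ {K} → Fin (suc K) → Fin K → Bool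
flips zero    _ = true
flips (suc i) r = does (i Fin.≟ r)

lookup-act : ∀ {K} (g : Fin (suc K)) r x → lookup (act g x) r ≡ flips g r xor lookup x r
lookup-act zero    r x = lookup-map r not x
lookup-act (suc i) r x with i Fin.≟ r
... | yes refl = lookup∘updateAt i x
... | no i≢r  = lookup∘updateAt′ r i (i≢r ∘ sym) x

act-involutive : ∀ {K} (g : Fin (suc K)) x → act g (act g x) ≡ x
act-involutive g x = lookup-extensionality λ r → begin
  lookup (act g (act g x)) r                  ≡⟨ lookup-act g r _ ⟩
  flips g r xor lookup (act g x) r            ≡⟨ cong (flips g r xor_) (lookup-act g r x) ⟩
  flips g r xor (flips g r xor lookup x r)    ≡⟨ xor-assoc (flips g r) _ _ ⟨
  (flips g r xor flips g r) xor lookup x r    ≡⟨ cong (_xor lookup x r) (xor-same (flips g r)) ⟩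
  lookup x r                                  ∎
  where open ≡-Reasoning

act-comm : ∀ {K} (g h : Fin (suc K)) x → act g (act h x) ≡ act h (act g x)
act-comm g h x = lookup-extensionality λ r → begin
  lookup (act g (act h x)) r                  ≡⟨ lookup-act g r _ ⟩
  flips g r xor lookup (act h x) r            ≡⟨ cong (flips g r xor_) (lookup-act h r x) ⟩
  flips g r xor (flips h r xor lookup x r)    ≡⟨ xor-assoc (flips g r) _ _ ⟨
  (flips g r xor flips h r) xor lookup x r    ≡⟨ cong (_xor lookup x r) (xor-comm (flips g r) _) ⟩
  (flips h r xor flips g r) xor lookup x r    ≡⟨ xor-assoc (flips h r) _ _ ⟩
  flips h r xor (flips g r xor lookup x r)    ≡⟨ cong (flips h r xor_) (lookup-act g r x) ⟨
  flips h r xor lookup (act g x) r            ≡⟨ lookup-act h r _ ⟨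
  lookup (act h (act g x)) r                  ∎
  where open ≡-Reasoning

act-swap : ∀ {K} (g : Fin (suc K)) {x y} → y ≡ act g x → x ≡ act g y
act-swap g {x} refl = sym (act-involutive g x)

act-cancelˡ : ∀ {K} (g : Fin (suc K)) {x y} → act g x ≡ act g y → x ≡ y
act-cancelˡ g {x} {y} e = trans (act-swap g refl) (trans (cong (act g) e) (act-involutive g y))

actAll : ∀ {K} → List (Fin (suc K)) → Vec Bool K → Vec Bool K
actAll gs x = foldr act x gs

flipParity : ∀ {K} → List (Fin (suc K)) → Fin K → Bool
flipParity gs r = foldr (λ g → flips g r xor_) false gs

lookup-actAll : ∀ {K} (gs : List (Fin (suc K))) r x → lookup (actAll gs x) r ≡ flipParity gs r xor lookup x r
lookup-actAll []       r x = refl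
lookup-actAll (g ∷ gs) r x = begin
  lookup (act g (actAll gs x)) r                    ≡⟨ lookup-act g r _ ⟩
  flips g r xor lookup (actAll gs x) r              ≡⟨ cong (flips g r xor_) (lookup-actAll gs r x) ⟩
  flips g r xor (flipParity gs r xor lookup x r)    ≡⟨ xor-assoc (flips g r) _ _ ⟨
  (flips g r xor flipParity gs r) xor lookup x r    ∎
  where open ≡-Reasoning

actAll-moves : ∀ {K} (gs : List (Fin (suc K))) {r} → flipParity gs r ≡ true → ∀ x → actAll gs x ≢ x
actAll-moves gs {r} odd x fixed = not-¬ refl (begin
  lookup x r                          ≡⟨ cong (λ y → lookup y r) fixed ⟨
  lookup (actAll gs x) r              ≡⟨ lookup-actAll gs r x ⟩
  flipParity gs r xor lookup x r      ≡⟨ cong (_xor lookup x r) odd ⟩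
  not (lookup x r)                    ∎)
  where open ≡-Reasoning

flipParity-single : ∀ {K} (gs : List (Fin (suc K))) g hs {r} → flips g r ≡ true →
                    All (λ h → flips h r ≡ false) gs → All (λ h → flips h r ≡ false) hs →
                    flipParity (gs ++ g ∷ hs) r ≡ true
flipParity-single []       g hs hit []              misses = cong₂ _xor_ hit (flipParity-misses hs misses)
  where
  flipParity-misses : ∀ hs → All (λ h → flips h _ ≡ false) hs → flipParity hs _ ≡ false
  flipParity-misses []       []              = refl
  flipParity-misses (h ∷ hs) (miss ∷ misses) = cong₂ _xor_ miss (flipParity-misses hs misses)
flipParity-single (h ∷ gs) g hs hit (miss ∷ misses) misses′ =
  cong₂ _xor_ miss (flipParity-single gs g hs hit misses misses′)

flips-self : ∀ {K} (i : Fin K) → flips (suc i) i ≡ true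
flips-self i = dec-true (i Fin.≟ i) refl

flips-other : ∀ {K} {i r : Fin K} → i ≢ r → flips (suc i) r ≡ false
flips-other {i = i} {r} = dec-false (i Fin.≟ r)

oddCoordinate₁ : ∀ {K} → 0 < K → (g : Fin (suc K)) → ∃ λ r → flipParity (g ∷ []) r ≡ true
oddCoordinate₁ 0<K zero    = proj₁ (∃-∉ 0<K []) , refl
oddCoordinate₁ _   (suc i) = i , flipParity-single [] (suc i) [] (flips-self i) [] []

oddCoordinate₂ : ∀ {K} → 1 < K → {g h : Fin (suc K)} → g ≢ h →
                 ∃ λ r → flipParity (g ∷ h ∷ []) r ≡ true
oddCoordinate₂ _   {zero}  {zero}  g≢h = ⊥-elim (g≢h refl)
oddCoordinate₂ 1<K {zero}  {suc j} _ =
  let r , r∉ = ∃-∉ 1<K (j ∷ []) in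
  r , flipParity-single [] zero (suc j ∷ []) refl [] (flips-other (r∉ ∘ here ∘ sym) ∷ [])
oddCoordinate₂ 1<K {suc i} {zero}  _ =
  let r , r∉ = ∃-∉ 1<K (i ∷ []) in
  r , flipParity-single (suc i ∷ []) zero [] refl (flips-other (r∉ ∘ here ∘ sym) ∷ []) []
oddCoordinate₂ _   {suc i} {suc j} g≢h =
  i , flipParity-single [] (suc i) (suc j ∷ []) (flips-self i) []
                        (flips-other (g≢h ∘ cong suc ∘ sym) ∷ [])

∃-unflipped₃ : ∀ {K} → 3 < K → (i j l : Fin K) →
               ∃ λ r → flips (suc i) r ≡ false × flips (suc j) r ≡ false × flips (suc l) r ≡ false
∃-unflipped₃ 3<K i j l =
  let r , r∉ = ∃-∉ 3<K (i ∷ j ∷ l ∷ []) in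
  r , flips-other (r∉ ∘ here ∘ sym) , flips-other (r∉ ∘ there ∘ here ∘ sym)
    , flips-other (r∉ ∘ there ∘ there ∘ here ∘ sym)

oddCoordinate₄ : ∀ {K} → 3 < K → {g₁ g₂ g₃ g₄ : Fin (suc K)} → Unique (g₁ ∷ g₂ ∷ g₃ ∷ g₄ ∷ []) →
                 ∃ λ r → flipParity (g₁ ∷ g₂ ∷ g₃ ∷ g₄ ∷ []) r ≡ true
oddCoordinate₄ _ {suc i} {suc j} {suc l} {suc m} ((i≢j ∷ i≢l ∷ i≢m ∷ []) ∷ _) =
  i , flipParity-single [] (suc i) (suc j ∷ suc l ∷ suc m ∷ []) (flips-self i) []
                        (other i≢j ∷ other i≢l ∷ other i≢m ∷ [])
  where
  other : ∀ {j} → suc i ≢ suc j → flips (suc j) i ≡ false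
  other i≢j = flips-other (i≢j ∘ cong suc ∘ sym)
oddCoordinate₄ 3<K {zero} {suc j} {suc l} {suc m} _ =
  let r , j✗ , l✗ , m✗ = ∃-unflipped₃ 3<K j l m in
  r , flipParity-single [] zero (suc j ∷ suc l ∷ suc m ∷ []) refl [] (j✗ ∷ l✗ ∷ m✗ ∷ [])
oddCoordinate₄ 3<K {suc i} {zero} {suc l} {suc m} _ =
  let r , i✗ , l✗ , m✗ = ∃-unflipped₃ 3<K i l m in
  r , flipParity-single (suc i ∷ []) zero (suc l ∷ suc m ∷ []) refl (i✗ ∷ []) (l✗ ∷ m✗ ∷ [])
oddCoordinate₄ 3<K {suc i} {suc j} {zero} {suc m} _ =
  let r , i✗ , j✗ , m✗ = ∃-unflipped₃ 3<K i j m in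
  r , flipParity-single (suc i ∷ suc j ∷ []) zero (suc m ∷ []) refl (i✗ ∷ j✗ ∷ []) (m✗ ∷ [])
oddCoordinate₄ 3<K {suc i} {suc j} {suc l} {zero} _ =
  let r , i✗ , j✗ , l✗ = ∃-unflipped₃ 3<K i j l in
  r , flipParity-single (suc i ∷ suc j ∷ suc l ∷ []) zero [] refl (i✗ ∷ j✗ ∷ l✗ ∷ []) []
oddCoordinate₄ _ {zero} {zero} ((g₁≢g₂ ∷ _) ∷ _) = ⊥-elim (g₁≢g₂ refl)
oddCoordinate₄ _ {zero} {_} {zero} ((_ ∷ g₁≢g₃ ∷ _) ∷ _) = ⊥-elim (g₁≢g₃ refl)
oddCoordinate₄ _ {zero} {_} {_} {zero} ((_ ∷ _ ∷ g₁≢g₄ ∷ _) ∷ _) = ⊥-elim (g₁≢g₄ refl)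
oddCoordinate₄ _ {_} {zero} {zero} (_ ∷ (g₂≢g₃ ∷ _) ∷ _) = ⊥-elim (g₂≢g₃ refl)
oddCoordinate₄ _ {_} {zero} {_} {zero} (_ ∷ (_ ∷ g₂≢g₄ ∷ _) ∷ _) = ⊥-elim (g₂≢g₄ refl)
oddCoordinate₄ _ {_} {_} {zero} {zero} (_ ∷ _ ∷ (g₃≢g₄ ∷ _) ∷ _) = ⊥-elim (g₃≢g₄ refl)

act-moves : ∀ {K} → 0 < K → (g : Fin (suc K)) (x : Vec Bool K) → act g x ≢ x
act-moves 0<K g = actAll-moves (g ∷ []) (proj₂ (oddCoordinate₁ 0<K g))

act∘act≡id⇒≡ : ∀ {K} → 1 < K → {g h : Fin (suc K)} {x : Vec Bool K} → act h (act g x) ≡ x → g ≡ h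
act∘act≡id⇒≡ 1<K {g} {h} {x} closed with g Fin.≟ h
... | yes g≡h = g≡h
... | no g≢h  = ⊥-elim (actAll-moves (h ∷ g ∷ []) (proj₂ (oddCoordinate₂ 1<K (≢-sym g≢h))) x closed)

act-cancelʳ : ∀ {K} → 1 < K → {g h : Fin (suc K)} (x : Vec Bool K) → act g x ≡ act h x → g ≡ h
act-cancelʳ 1<K {h = h} x e = act∘act≡id⇒≡ 1<K (trans (cong (act h) e) (act-involutive h x))

closed-4-walk⇒g₁≡g₃ : ∀ {K} → 3 < K → {g₁ g₂ g₃ g₄ : Fin (suc K)} {x : Vec Bool K} →
                      g₁ ≢ g₂ → g₂ ≢ g₃ → g₃ ≢ g₄ → g₄ ≢ g₁ →
                      act g₄ (act g₃ (act g₂ (act g₁ x))) ≡ x → g₁ ≡ g₃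
closed-4-walk⇒g₁≡g₃ 3<K {g₁} {g₂} {g₃} {g₄} {x} g₁≢g₂ g₂≢g₃ g₃≢g₄ g₄≢g₁ closed
  with g₁ Fin.≟ g₃ | g₂ Fin.≟ g₄
... | yes g₁≡g₃ | _ = g₁≡g₃
... | no _ | yes refl = act∘act≡id⇒≡ (≤-trans (s≤s (s≤s z≤n)) 3<K) (begin
  act g₃ (act g₁ x)                      ≡⟨ act-involutive g₂ _ ⟨
  act g₂ (act g₂ (act g₃ (act g₁ x)))    ≡⟨ cong (act g₂) (act-comm g₃ g₂ _) ⟨
  act g₂ (act g₃ (act g₂ (act g₁ x)))    ≡⟨ closed ⟩
  x                                      ∎)
  where open ≡-Reasoning
... | no g₁≢g₃ | no g₂≢g₄ =
  ⊥-elim (actAll-moves (g₄ ∷ g₃ ∷ g₂ ∷ g₁ ∷ []) (proj₂ (oddCoordinate₄ 3<K distinct)) x closed)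
  where
  distinct : Unique (g₄ ∷ g₃ ∷ g₂ ∷ g₁ ∷ [])
  distinct = (≢-sym g₃≢g₄ ∷ ≢-sym g₂≢g₄ ∷ g₄≢g₁ ∷ []) ∷ (≢-sym g₂≢g₃ ∷ ≢-sym g₁≢g₃ ∷ [])
           ∷ (≢-sym g₁≢g₂ ∷ []) ∷ [] ∷ []

hamming-refl : ∀ {k} (x : Vec Bool k) → hamming x x ≡ 0
hamming-refl []          = refl
hamming-refl (true ∷ x)  = hamming-refl x
hamming-refl (false ∷ x) = hamming-refl x

hamming≡0⇒≡ : ∀ {k} (x y : Vec Bool k) → hamming x y ≡ 0 → x ≡ y
hamming≡0⇒≡ []          []          _ = refl
hamming≡0⇒≡ (true ∷ x)  (true ∷ y)  e = cong (true ∷_) (hamming≡0⇒≡ x y e)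
hamming≡0⇒≡ (false ∷ x) (false ∷ y) e = cong (false ∷_) (hamming≡0⇒≡ x y e)

hamming-flip : ∀ {k} (i : Fin k) (x : Vec Bool k) → hamming x (updateAt x i not) ≡ 1
hamming-flip zero    (true ∷ x)  = cong suc (hamming-refl x)
hamming-flip zero    (false ∷ x) = cong suc (hamming-refl x)
hamming-flip (suc i) (true ∷ x)  = hamming-flip i x
hamming-flip (suc i) (false ∷ x) = hamming-flip i x

hamming≡1⇒flip : ∀ {k} (x y : Vec Bool k) → hamming x y ≡ 1 → ∃ λ i → y ≡ updateAt x i not
hamming≡1⇒flip []          []          ()
hamming≡1⇒flip (true ∷ x)  (false ∷ y) e = zero , cong (false ∷_) (sym (hamming≡0⇒≡ x y (suc-injective e)))
hamming≡1⇒flip (false ∷ x) (true ∷ y)  e = zero , cong (true ∷_) (sym (hamming≡0⇒≡ x y (suc-injective e)))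
hamming≡1⇒flip (true ∷ x)  (true ∷ y)  e = let i , y≡ = hamming≡1⇒flip x y e in suc i , cong (true ∷_) y≡
hamming≡1⇒flip (false ∷ x) (false ∷ y) e = let i , y≡ = hamming≡1⇒flip x y e in suc i , cong (false ∷_) y≡

isOne⇒≡1 : ∀ n → T (isOne n) → n ≡ 1
isOne⇒≡1 1 _ = refl

adjFQ⇒act : ∀ {K} (x y : Vec Bool K) → T (adjFQ x y) → ∃ λ g → y ≡ act g x
adjFQ⇒act x y adj with eqV y (map not x)
... | yes y≡x̄ = zero , y≡x̄
... | no _ with eqV x y
...   | no _ =
  let i , y≡ = hamming≡1⇒flip x y (isOne⇒≡1 _ (subst T (∨-identityʳ _) adj)) in suc i , y≡

act⇒adjFQ : ∀ {K} → 0 < K → (g : Fin (suc K)) (x : Vec Bool K) → T (adjFQ x (act g x))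
act⇒adjFQ 0<K g x rewrite dec-no (eqV x (act g x)) (act-moves 0<K g x ∘ sym) = differ g
  where
  differ : ∀ g → T (isOne (hamming x (act g x)) ∨ ⌊ eqV (act g x) (map not x) ⌋)
  differ zero    rewrite dec-yes-recompute (eqV (map not x) (map not x)) refl = Equivalence.from T-∨ (inj₂ tt)
  differ (suc i) rewrite hamming-flip i x = tt

act⇒adjFQ′ : ∀ {K} → 0 < K → (g : Fin (suc K)) (x : Vec Bool K) → T (adjFQ (act g x) x)
act⇒adjFQ′ 0<K g x = subst (λ y → T (adjFQ (act g x) y)) (act-involutive g x) (act⇒adjFQ 0<K g (act g x))

module FoldedCubeSquares {K : ℕ} (3<K : 3 < K) where
  open Squares {Vec Bool K} eqV adjFQ

  0<K : 0 < K
  0<K = ≤-trans (s≤s z≤n) 3<K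

  1<K : 1 < K
  1<K = ≤-trans (s≤s (s≤s z≤n)) 3<K

  module _ (a : Vec Bool K) (g₁ : Fin (suc K)) where
    private
      b : Vec Bool K
      b = act g₁ a

    spannedSquare : ∀ {g₂} → g₂ ≢ g₁ → Square a b (act g₂ b) (act g₂ a)
    spannedSquare {g₂} g₂≢g₁ = record
      { a≢b = act-moves 0<K g₁ a ∘ sym
      ; a≢c = λ a≡c → g₂≢g₁ (sym (act∘act≡id⇒≡ 1<K (sym a≡c)))
      ; a≢d = act-moves 0<K g₂ a ∘ sym
      ; b≢c = act-moves 0<K g₂ b ∘ sym
      ; b≢d = g₂≢g₁ ∘ sym ∘ act-cancelʳ 1<K a
      ; c≢d = act-moves 0<K g₁ a ∘ act-cancelˡ g₂
      ; ab = act⇒adjFQ 0<K g₁ a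
      ; bc = act⇒adjFQ 0<K g₂ b
      ; cd = subst (λ c → T (adjFQ c (act g₂ a))) (act-comm g₁ g₂ a) (act⇒adjFQ′ 0<K g₁ (act g₂ a))
      ; da = act⇒adjFQ′ 0<K g₂ a
      }

    square-closes : ∀ {g₂ c d} → Square a b c d → c ≡ act g₂ b → d ≡ act g₂ a
    square-closes {g₂} {c} {d} s refl with adjFQ⇒act c d (Square.cd s) | adjFQ⇒act d a (Square.da s)
    ... | g₃ , d≡g₃c | g₄ , a≡g₄d = begin
      d                            ≡⟨ d≡g₃c ⟩
      act g₃ c                     ≡⟨ cong (λ g → act g c) g₁≡g₃ ⟨
      act g₁ (act g₂ (act g₁ a))   ≡⟨ cong (act g₁) (act-comm g₂ g₁ a) ⟩
      act g₁ (act g₁ (act g₂ a))   ≡⟨ act-involutive g₁ _ ⟩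
      act g₂ a                     ∎
      where
      open ≡-Reasoning
      open Square s
      g₁≢g₂ : g₁ ≢ g₂
      g₁≢g₂ refl = a≢c (sym (act-involutive g₁ a))
      g₂≢g₃ : g₂ ≢ g₃
      g₂≢g₃ refl = b≢d (sym (trans d≡g₃c (act-involutive g₂ b)))
      g₃≢g₄ : g₃ ≢ g₄
      g₃≢g₄ refl = a≢c (trans a≡g₄d (trans (cong (act g₃) d≡g₃c) (act-involutive g₃ c)))
      g₄≢g₁ : g₄ ≢ g₁
      g₄≢g₁ refl = b≢d (sym (act-swap g₁ a≡g₄d))
      g₁≡g₃ : g₁ ≡ g₃
      g₁≡g₃ = closed-4-walk⇒g₁≡g₃ 3<K g₁≢g₂ g₂≢g₃ g₃≢g₄ g₄≢g₁ (sym (trans a≡g₄d (cong (act g₄) d≡g₃c)))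

    square : (y : SquaresOn a b) → Square a b (proj₁ y) (proj₁ (proj₂ y))
    square (c , d , s) = isSquare⇒Square {a} {b} {c} {d} s

    generatorOf : (y : SquaresOn a b) → ∃ λ g₂ → proj₁ y ≡ act g₂ b
    generatorOf y = adjFQ⇒act b (proj₁ y) (Square.bc (square y))

    g₁≢generatorOf : (y : SquaresOn a b) → g₁ ≢ proj₁ (generatorOf y)
    g₁≢generatorOf y@(c , _ , _) g₁≡g₂ = Square.a≢c (square y) (begin
      a                              ≡⟨ act-involutive g₁ a ⟨
      act g₁ b                       ≡⟨ cong (λ g → act g b) g₁≡g₂ ⟩
      act (proj₁ (generatorOf y)) b  ≡⟨ proj₂ (generatorOf y) ⟨
      c                              ∎)
      where open ≡-Reasoning

    Fin↔squaresOn : Fin K ↔ SquaresOn a b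
    Fin↔squaresOn = mk↔ₛ′ to from to∘from from∘to
      where
      to : Fin K → SquaresOn a b
      to j = act g₂ b , act g₂ a , Square⇒isSquare (spannedSquare (punchInᵢ≢i g₁ j))
        where g₂ = punchIn g₁ j

      from : SquaresOn a b → Fin K
      from y = punchOut (g₁≢generatorOf y)

      to∘from : ∀ y → to (from y) ≡ y
      to∘from y@(c , d , _) = SquaresOn-≡ {a} {b} c≡ d≡
        where
        g₂ = proj₁ (generatorOf y)
        punchIn≡g₂ : punchIn g₁ (from y) ≡ g₂
        punchIn≡g₂ = punchIn-punchOut (g₁≢generatorOf y)
        c≡ : act (punchIn g₁ (from y)) b ≡ c
        c≡ = trans (cong (λ g → act g b) punchIn≡g₂) (sym (proj₂ (generatorOf y)))
        d≡ : act (punchIn g₁ (from y)) a ≡ d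
        d≡ = trans (cong (λ g → act g a) punchIn≡g₂)
                   (sym (square-closes {g₂ = g₂} (square y) (proj₂ (generatorOf y))))

      from∘to : ∀ j → from (to j) ≡ j
      from∘to j = trans (punchOut-cong g₁ (sym (act-cancelʳ 1<K b (proj₂ (generatorOf (to j))))))
                        (punchOut-punchIn g₁)

  FQ-cycleRegular : FQCycleRegular (suc K) 1 K 4
  FQ-cycleRegular (a ∷ b ∷ []) path with adjFQ⇒act a b (isPath⇒adj {a} {b} path)
  ... | g , refl = ↔-trans (Fin↔squaresOn a g) (↔-sym (cyclesThrough↔squaresOn a (act g a)))

module SmallFoldedCubes (k : ℕ) where
  open Squares {Vec Bool k} eqV adjFQ
  open CycleReg {Vec Bool k} eqV adjFQ using (CyclesThrough)

  squareCount : Vec Bool k → Vec Bool k → ℕ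
  squareCount a b = sumVec k λ c → sumVec k λ d → indicator (isSquare a b c d)

  squaresOn↔Fin : ∀ a b → SquaresOn a b ↔ Fin (squareCount a b)
  squaresOn↔Fin a b =
    ↔-trans (Σ-↔ ↔-refl (Σ-↔ ↔-refl (T↔Fin-indicator _)))
            (↔-trans (Σ-↔ ↔-refl (Σ-Fin↔Fin-sumVec k _)) (Σ-Fin↔Fin-sumVec k _))

  FQ-cycleRegular-byCount :
    ∀ l → T (allVec k λ a → allVec k λ b → not (adjFQ a b) ∨ (squareCount a b ≡ᵇ l)) →
    FQCycleRegular (suc k) 1 l 4
  FQ-cycleRegular-byCount l check (a ∷ b ∷ []) path =
    subst (λ m → Fin m ↔ CyclesThrough 4 (a ∷ b ∷ [])) count≡l
          (↔-sym (↔-trans (cyclesThrough↔squaresOn a b) (squaresOn↔Fin a b)))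
    where
    modusPonens : ∀ {p q} → T (not p ∨ q) → T p → T q
    modusPonens {true} q _ = q
    count≡l : squareCount a b ≡ l
    count≡l = ≡ᵇ⇒≡ _ _ (modusPonens (allVec-sound k _ (allVec-sound k _ check a) b)
                                    (isPath⇒adj {a} {b} path))

open SmallFoldedCubes using (FQ-cycleRegular-byCount)
open FoldedCubeSquares using (FQ-cycleRegular)

theorem5 : FQCycleRegular 1 1 0 4 × FQCycleRegular 2 1 0 4 × FQCycleRegular 4 1 9 4
           × ((n : ℕ) → 1 ≤ n → n ≢ 1 → n ≢ 2 → n ≢ 4 → FQCycleRegular n 1 (n ∸ 1) 4)
theorem5 =
  FQ-cycleRegular-byCount 0 0 tt , FQ-cycleRegular-byCount 1 0 tt , FQ-cycleRegular-byCount 3 9 tt , others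
  where
  others : (n : ℕ) → 1 ≤ n → n ≢ 1 → n ≢ 2 → n ≢ 4 → FQCycleRegular n 1 (n ∸ 1) 4
  others 0 ()
  others 1 _ n≢1 _   _   = ⊥-elim (n≢1 refl)
  others 2 _ _   n≢2 _   = ⊥-elim (n≢2 refl)
  others 3 _ _   _   _   = FQ-cycleRegular-byCount 2 2 tt
  others 4 _ _   _   n≢4 = ⊥-elim (n≢4 refl)
  others (suc (suc (suc (suc (suc k))))) _ _ _ _ = FQ-cycleRegular (s≤s (s≤s (s≤s (s≤s z≤n))))
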